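{- For the triangle game on the triangular grid with $n$ winning sets, $\mathrm{SC}_2(\mathcal G_{\triangle},3)\ge \frac{n}{28}-o(n)$.
   Context: An $s$-of-$k$ game on a $k$-uniform hypergraph $(V,\mathcal F)$ (winning sets are $k$-element subsets of the finite set $V$), $1\le s\le k$: Maker and Breaker alternately claim unclaimed vertices, Maker first, until all are claimed; the score is the number of winning sets in which Maker claimed at least $s$ vertices (Maker maximizes, Breaker minimizes). A pairing strategy for Maker: she fixes in advance pairwise disjoint pairs of vertices and, whenever Breaker claims a vertex of a pair whose partner is unclaimed, she claims the partner (other moves arbitrary). $\mathrm{SC}_2(\mathcal H,s)$ is the largest score Maker can guarantee against every Breaker strategy using a pairing strategy. $\mathcal G_{\triangle}$ is the hypergraph whose vertices are the points of a finite portion of the triangular lattice and whose winning sets are the vertex sets of the unit triangular faces (both orientations), so $k=3$. Grids are assumed "two-dimensional": the number of winning sets within constant distance of the boundary is $o(n)$, where $n$ is the number of winning sets; $o(n)$ refers to $n\to\infty$. -}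

module Defs where

open import Data.Nat as ℕ using (ℕ; zero; suc; _≤_)
import Data.Integer as ℤ
open ℤ using (ℤ; +_)
open import Data.Product using (Σ; _×_; _,_)
open import Data.Product.Properties using (≡-dec)
open import Data.List using (List; []; _∷_; filter; length; map; concatMap; upTo)
open import Data.List.Relation.Unary.All using (All)
open import Data.List.Relation.Unary.Any using (any?)
open import Data.List.Relation.Unary.Unique.Propositional using (Unique)
open import Data.Maybe using (Maybe; just; nothing)
open import Relation.Nullary using (yes; no; ¬?)
open import Relation.Binary.PropositionalEquality using (_≡_)
open import Relation.Binary.Definitions using (DecidableEquality)

-- Points of the triangular lattice in axial coordinates: (a , b) is adjacent to
-- (a±1 , b), (a , b±1), (a+1 , b-1), (a-1 , b+1).
Pt : Set
Pt = ℤ × ℤ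

_≟P_ : DecidableEquality Pt
_≟P_ = ≡-dec ℤ._≟_ ℤ._≟_

open import Data.List.Membership.DecPropositional _≟P_ public using (_∈?_)
open import Data.List.Membership.Propositional public using (_∈_)

data Orient : Set where
  up down : Orient

Tri : Set
Tri = Orient × Pt

corners : Tri → List Pt
corners (up , (a , b))   = (a , b) ∷ (a ℤ.+ ℤ.1ℤ , b) ∷ (a , b ℤ.+ ℤ.1ℤ) ∷ []
corners (down , (c , d)) = (c , d) ∷ (c , d ℤ.- ℤ.1ℤ) ∷ (c ℤ.- ℤ.1ℤ , d) ∷ []

winningSets : List Pt → List Tri
winningSets V =
  filter (λ T → Data.List.Relation.Unary.All.all? (_∈? V) (corners T))
         (concatMap (λ v → (up , v) ∷ (down , v) ∷ []) V)

numWin : List Pt → ℕ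
numWin V = length (winningSets V)

score : ℕ → List Pt → List Pt → ℕ
score s V M =
  length (filter (λ T → s ℕ.≤? length (filter (_∈? M) (corners T))) (winningSets V))

-- box of lattice points around p at coordinate distance ≤ d
-- (equivalent to the lattice graph distance up to a factor 2)
range : ℕ → List ℤ
range d = map (λ i → (+ i) ℤ.- (+ d)) (upTo (suc (d ℕ.+ d)))

box : ℕ → Pt → List Pt
box d (a , b) = concatMap (λ i → map (λ j → (a ℤ.+ i , b ℤ.+ j)) (range d)) (range d)

boundaryCount : List Pt → ℕ → ℕ
boundaryCount V d =
  length (filter (λ T → any? (λ w → any? (λ p → ¬? (p ∈? V)) (box d w)) (corners T))
                 (winningSets V))

partner : List (Pt × Pt) → Pt → Maybe Pt
partner [] u = nothing
partner ((x , y) ∷ P) u with u ≟P x | u ≟P y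
... | yes _ | _     = just y
... | no _  | yes _ = just x
... | no _  | no _  = partner P u

pairElems : List (Pt × Pt) → List Pt
pairElems = concatMap (λ { (x , y) → x ∷ y ∷ [] })

IsPairing : List Pt → List (Pt × Pt) → Set
IsPairing V P = Unique (pairElems P) × All (_∈ V) (pairElems P)

remove : Pt → List Pt → List Pt
remove u = filter (λ w → ¬? (w ≟P u))

forcedAfter : List (Pt × Pt) → Pt → List Pt → Maybe Pt
forcedAfter P u U' with partner P u
... | nothing = nothing
... | just v with v ∈? U'
...   | yes _ = just v
...   | no _  = nothing

-- The game tree: Maker (following pairing P) can force final score ≥ t.
-- MakerTurn f M U : Maker to move, Maker has claimed M, U is unclaimed,
-- f = just v if the pairing forces Maker to claim v now.
mutual
  data MakerTurn (V : List Pt) (s t : ℕ) (P : List (Pt × Pt)) :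
       Maybe Pt → List Pt → List Pt → Set where
    mEnd    : ∀ {f M} → t ≤ score s V M → MakerTurn V s t P f M []
    mFree   : ∀ {M U u} → u ∈ U → BreakerTurn V s t P (u ∷ M) (remove u U) →
              MakerTurn V s t P nothing M U
    mForced : ∀ {M U v} → v ∈ U → BreakerTurn V s t P (v ∷ M) (remove v U) →
              MakerTurn V s t P (just v) M U

  data BreakerTurn (V : List Pt) (s t : ℕ) (P : List (Pt × Pt)) :
       List Pt → List Pt → Set where
    bEnd  : ∀ {M} → t ≤ score s V M → BreakerTurn V s t P M []
    bStep : ∀ {M x xs} →
            (∀ u → u ∈ (x ∷ xs) →
               MakerTurn V s t P (forcedAfter P u (remove u (x ∷ xs))) M (remove u (x ∷ xs))) →
            BreakerTurn V s t P M (x ∷ xs)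

-- Maker can guarantee score ≥ t with a pairing strategy, i.e. SC₂(G_△(V), s) ≥ t.
PairingGuarantees : List Pt → ℕ → ℕ → Set
PairingGuarantees V s t =
  Σ (List (Pt × Pt)) λ P → IsPairing V P × MakerTurn V s t P nothing [] V

-- Cells (k , l) of the lattice spanned by (7 , 0) and (3 , 2) tile the plane in two ways: by
-- 7 × 2 blocks, and by 14-point gadgets (a 4 × 4 rhombus minus two opposite corners).  Inside
-- every gadget lying in V, Maker answers Breaker within seven fixed pairs; checking all 2⁷ ways
-- of getting one point of each pair shows that she always completes a unit triangle of that
-- gadget, so her score is at least the number t of such gadgets.  Conversely, a winning set
-- farther than 6 from the boundary is anchored in the block of a cell whose gadget lies in V,
-- and each block anchors 2 · 14 = 28 triangles, so n ≤ (sets near the boundary) + 28 t.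

module Submission where

open import Defs
open import Data.Product using (Σ; ∃; _×_; _,_; proj₁; proj₂)
open import Data.Product.Properties using (≡-dec)
open import Data.Sum as Sum using (_⊎_; inj₁; inj₂)
open import Data.Maybe using (Maybe; just; nothing)
open import Data.List
  using (List; []; _∷_; _++_; map; concatMap; filter; length; upTo; cartesianProduct; deduplicate)
open import Data.List.Relation.Unary.All as All using (All; []; _∷_; all?)
import Data.List.Relation.Unary.All.Properties as All
open import Data.List.Relation.Unary.Any as Any using (Any; any?; here; there)
import Data.List.Relation.Unary.Any.Properties as Any
open import Data.List.Relation.Unary.AllPairs as AllPairs using ([]; _∷_)
import Data.List.Relation.Unary.AllPairs.Properties as AllPairs
open import Data.List.Relation.Unary.Unique.Propositional using (Unique)
import Data.List.Relation.Unary.Unique.Propositional.Properties as Unique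
open import Data.List.Membership.Propositional using (find; lose)
open import Data.List.Membership.Propositional.Properties
  using (∈-∃++; ∈-++⁻; ∈-++⁺ˡ; ∈-++⁺ʳ; ∈-map⁺; ∈-map⁻; ∈-filter⁺; ∈-filter⁻; ∈-concatMap⁺;
         ∈-deduplicate⁺; ∈-upTo⁺; ∈-cartesianProduct⁺)
open import Function using (_∘′_)
open import Relation.Nullary using (¬_; ¬?; yes; no; contradiction)
open import Relation.Nullary.Decidable using (from-yes; decidable-stable; _→-dec_; _×-dec_)
open import Relation.Unary using (Decidable)
open import Relation.Unary.Properties using (∁?)
open import Relation.Binary.Definitions using (DecidableEquality)
open import Relation.Binary.PropositionalEquality
  using (_≡_; _≢_; refl; sym; trans; cong; cong₂; subst; module ≡-Reasoning)

module Lists where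

  open import Data.Nat using (suc; _≤_; _*_; _+_; z≤n; s≤s)
  open import Data.Nat.Properties using (+-suc; module ≤-Reasoning)
  open import Data.List.Properties using (length-++; length-map; length-++-sucʳ)

  private variable
    A B T : Set

  length-≤-injection : (R : A → B → Set) {xs : List A} {ys : List B} → Unique xs →
    (∀ {x} → x ∈ xs → ∃ λ y → y ∈ ys × R x y) →
    (∀ {x x′ y} → R x y → R x′ y → x ≡ x′) →
    length xs ≤ length ys
  length-≤-injection R {[]} _ _ _ = z≤n
  length-≤-injection R {x ∷ xs} (x∉xs ∷ xs!) image functional with image (here refl)
  ... | y , y∈ys , Rxy with ∈-∃++ y∈ys
  ...   | ys₁ , ys₂ , refl = begin
    suc (length xs)           ≤⟨ s≤s (length-≤-injection R xs! image′ functional) ⟩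
    suc (length (ys₁ ++ ys₂)) ≡⟨ length-++-sucʳ ys₁ y ys₂ ⟨
    length (ys₁ ++ y ∷ ys₂)   ∎
    where
    open ≤-Reasoning
    image′ : ∀ {x′} → x′ ∈ xs → ∃ λ y′ → y′ ∈ ys₁ ++ ys₂ × R x′ y′
    image′ x′∈xs with image (there x′∈xs)
    ... | y′ , y′∈ys , Rx′y′ with ∈-++⁻ ys₁ y′∈ys
    ...   | inj₁ y′∈ys₁         = y′ , ∈-++⁺ˡ y′∈ys₁ , Rx′y′
    ...   | inj₂ (there y′∈ys₂) = y′ , ∈-++⁺ʳ ys₁ y′∈ys₂ , Rx′y′
    ...   | inj₂ (here refl)    = contradiction (functional Rxy Rx′y′) (All.lookup x∉xs x′∈xs)

  concatMap-unique : (f : A → List B) {xs : List A} → Unique xs → (∀ x → Unique (f x)) →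
    (∀ {x x′ z} → z ∈ f x → z ∈ f x′ → x ≡ x′) → Unique (concatMap f xs)
  concatMap-unique f {xs} xs! f! separate =
    Unique.concat⁺ (All.map⁺ (All.universal f! xs))
      (AllPairs.map⁺ (AllPairs.map (λ x≢x′ {_} (z∈fx , z∈fx′) → x≢x′ (separate z∈fx z∈fx′)) xs!))

  length-filter-∁ : ∀ {P : A → Set} (P? : Decidable P) xs →
    length (filter P? xs) + length (filter (∁? P?) xs) ≡ length xs
  length-filter-∁ P? [] = refl
  length-filter-∁ P? (x ∷ xs) with P? x
  ... | yes _ = cong suc (length-filter-∁ P? xs)
  ... | no  _ = trans (+-suc _ _) (cong suc (length-filter-∁ P? xs))

  length-cartesianProduct : (xs : List A) (ys : List B) →
    length (cartesianProduct xs ys) ≡ length xs * length ys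
  length-cartesianProduct [] ys = refl
  length-cartesianProduct (x ∷ xs) ys =
    trans (length-++ (map (x ,_) ys))
          (cong₂ _+_ (length-map (x ,_) ys) (length-cartesianProduct xs ys))

  selections : List (A × A) → List (List A)
  selections [] = [] ∷ []
  selections ((x , y) ∷ ps) = map (x ∷_) (selections ps) ++ map (y ∷_) (selections ps)

  selection-meeting : ∀ {P : A → Set} ps → (∀ {x y} → (x , y) ∈ ps → P x ⊎ P y) →
    Any (All P) (selections ps)
  selection-meeting [] _ = here []
  selection-meeting ((x , y) ∷ ps) meets with meets (here refl)
  ... | inj₁ Px = Any.++⁺ˡ (Any.map⁺ (Any.map (Px ∷_) (selection-meeting ps (meets ∘′ there))))
  ... | inj₂ Py = Any.++⁺ʳ _ (Any.map⁺ (Any.map (Py ∷_) (selection-meeting ps (meets ∘′ there))))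

  forced-by-pairing : ∀ {P : A → Set} (shape : T → List A) {ts : List T} ps →
    All (λ sel → Any (λ t → All (_∈ sel) (shape t)) ts) (selections ps) →
    (∀ {x y} → (x , y) ∈ ps → P x ⊎ P y) →
    Any (λ t → All P (shape t)) ts
  forced-by-pairing shape ps covered meets with find (selection-meeting ps meets)
  ... | sel , sel∈ , Psel = Any.map (All.map (All.lookup Psel)) (All.lookup covered sel∈)

open Lists

module PairingStrategy where

  open import Data.Nat using (zero; suc; _≤_; _<_)
  open import Data.Nat.Properties using (≤-refl; ≤-trans; ≤-pred)
  open import Data.Empty using (⊥-elim)
  open import Data.Maybe.Properties using (just-injective)
  open import Data.List.Properties using (filter-notAll; concatMap-++)
  open import Data.List.Relation.Unary.All.Properties using (All¬⇒¬Any)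

  MeetsAll : List (Pt × Pt) → List Pt → Set
  MeetsAll P M = ∀ {x y} → (x , y) ∈ P → x ∈ M ⊎ y ∈ M

  private variable
    A : Set
    P : List (Pt × Pt)
    M U : List Pt
    u v x y : Pt

  pairElems-concatMap : (f : A → List (Pt × Pt)) (xs : List A) →
    pairElems (concatMap f xs) ≡ concatMap (pairElems ∘′ f) xs
  pairElems-concatMap f [] = refl
  pairElems-concatMap f (x ∷ xs) =
    trans (concatMap-++ _ (f x) (concatMap f xs)) (cong (pairElems (f x) ++_) (pairElems-concatMap f xs))

  fst∈pairElems : (x , y) ∈ P → x ∈ pairElems P
  fst∈pairElems {P = _ ∷ _} (here refl) = here refl
  fst∈pairElems {P = _ ∷ _} (there p)   = there (there (fst∈pairElems p))

  snd∈pairElems : (x , y) ∈ P → y ∈ pairElems P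
  snd∈pairElems {P = _ ∷ _} (here refl) = there (here refl)
  snd∈pairElems {P = _ ∷ _} (there p)   = there (there (snd∈pairElems p))

  pair-≢ : Unique (pairElems P) → (x , y) ∈ P → x ≢ y
  pair-≢ ((x≢y ∷ _) ∷ _) (here refl) = x≢y
  pair-≢ (_ ∷ _ ∷ P!)    (there p)   = pair-≢ P! p

  partner-fst : ∀ P → Unique (pairElems P) → (x , y) ∈ P → partner P x ≡ just y
  partner-fst {x} ((a , b) ∷ P) P! p with x ≟P a | x ≟P b
  partner-fst ((a , b) ∷ P) _ (here refl) | yes _   | _ = refl
  partner-fst ((a , b) ∷ P) _ (here refl) | no a≢a | _ = contradiction refl a≢a
  partner-fst ((a , b) ∷ P) (a∉ ∷ _ ∷ _) (there p) | yes refl | _ =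
    ⊥-elim (All¬⇒¬Any a∉ (there (fst∈pairElems p)))
  partner-fst ((a , b) ∷ P) (_ ∷ b∉ ∷ _) (there p) | no _ | yes refl =
    ⊥-elim (All¬⇒¬Any b∉ (fst∈pairElems p))
  partner-fst ((a , b) ∷ P) (_ ∷ _ ∷ P!) (there p) | no _ | no _ = partner-fst P P! p

  partner-snd : ∀ P → Unique (pairElems P) → (x , y) ∈ P → partner P y ≡ just x
  partner-snd {y = y} ((a , b) ∷ P) P! p with y ≟P a | y ≟P b
  partner-snd ((a , b) ∷ P) ((a≢a ∷ _) ∷ _) (here refl) | yes refl | _ = contradiction refl a≢a
  partner-snd ((a , b) ∷ P) _ (here refl) | no _ | yes _   = refl
  partner-snd ((a , b) ∷ P) _ (here refl) | no _ | no b≢b = contradiction refl b≢b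
  partner-snd ((a , b) ∷ P) (a∉ ∷ _ ∷ _) (there p) | yes refl | _ =
    ⊥-elim (All¬⇒¬Any a∉ (there (snd∈pairElems p)))
  partner-snd ((a , b) ∷ P) (_ ∷ b∉ ∷ _) (there p) | no _ | yes refl =
    ⊥-elim (All¬⇒¬Any b∉ (snd∈pairElems p))
  partner-snd ((a , b) ∷ P) (_ ∷ _ ∷ P!) (there p) | no _ | no _ = partner-snd P P! p

  ∈-remove⁺ : x ∈ U → x ≢ u → x ∈ remove u U
  ∈-remove⁺ {u = u} = ∈-filter⁺ (λ w → ¬? (w ≟P u))

  length-remove : u ∈ U → length (remove u U) < length U
  length-remove {u} {U} u∈U =
    filter-notAll (λ w → ¬? (w ≟P u)) U (Any.map (λ u≡w w≢u → w≢u (sym u≡w)) u∈U)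

  module _ {P : List (Pt × Pt)} (P! : Unique (pairElems P)) where

    Safe : List Pt → List Pt → Set
    Safe M U = ∀ {x y} → (x , y) ∈ P → x ∈ M ⊎ y ∈ M ⊎ (x ∈ U × y ∈ U)

    Safe-weaken : Safe M U → Safe (v ∷ M) U
    Safe-weaken safe p = Sum.map there (Sum.map₁ there) (safe p)

    Safe-remove : Safe M U →
      (∀ {x y} → (x , y) ∈ P → x ∈ U → y ∈ U → x ≡ u ⊎ y ≡ u → x ∈ M ⊎ y ∈ M) →
      Safe M (remove u U)
    Safe-remove {u = u} safe answered {x} {y} p with safe p
    ... | inj₁ x∈M        = inj₁ x∈M
    ... | inj₂ (inj₁ y∈M) = inj₂ (inj₁ y∈M)
    ... | inj₂ (inj₂ (x∈U , y∈U)) with x ≟P u | y ≟P u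
    ...   | yes x≡u | _       = Sum.map₂ inj₁ (answered p x∈U y∈U (inj₁ x≡u))
    ...   | no _    | yes y≡u = Sum.map₂ inj₁ (answered p x∈U y∈U (inj₂ y≡u))
    ...   | no x≢u  | no y≢u  = inj₂ (inj₂ (∈-remove⁺ x∈U x≢u , ∈-remove⁺ y∈U y≢u))

    Safe-claimed : Safe (v ∷ M) U → Safe (v ∷ M) (remove v U)
    Safe-claimed safe = Safe-remove safe λ _ _ _ → Sum.map here here

    Safe-take : Safe M U → Safe (u ∷ M) (remove u U)
    Safe-take safe = Safe-claimed (Safe-weaken safe)

    partner-through : partner P u ≡ just v → (x , y) ∈ P → x ≡ u ⊎ y ≡ u →
      (x ≡ u × y ≡ v) ⊎ (y ≡ u × x ≡ v)
    partner-through eq p (inj₁ refl) = inj₁ (refl , just-injective (trans (sym (partner-fst _ P! p)) eq))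
    partner-through eq p (inj₂ refl) = inj₂ (refl , just-injective (trans (sym (partner-snd _ P! p)) eq))

    unpaired : partner P u ≡ nothing → (x , y) ∈ P → ¬ (x ≡ u ⊎ y ≡ u)
    unpaired eq p (inj₁ refl) with () ← trans (sym eq) (partner-fst _ P! p)
    unpaired eq p (inj₂ refl) with () ← trans (sym eq) (partner-snd _ P! p)

    Pending : Maybe Pt → List Pt → List Pt → Set
    Pending nothing  M U = Safe M U
    Pending (just v) M U = v ∈ U × Safe (v ∷ M) (remove v U)

    Safe-after-breaker : Safe M U → Pending (forcedAfter P u (remove u U)) M (remove u U)
    Safe-after-breaker {M} {U} {u} safe with partner P u in eq
    ... | nothing = Safe-remove safe λ p _ _ through → ⊥-elim (unpaired eq p through)
    ... | just v with v ∈? remove u U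
    ...   | yes v∈U′ = v∈U′ , Safe-claimed (Safe-remove (Safe-weaken safe) answered)
      where
      answered : ∀ {x y} → (x , y) ∈ P → x ∈ U → y ∈ U → x ≡ u ⊎ y ≡ u → x ∈ v ∷ M ⊎ y ∈ v ∷ M
      answered p _ _ through with partner-through eq p through
      ... | inj₁ (_ , y≡v) = inj₂ (here y≡v)
      ... | inj₂ (_ , x≡v) = inj₁ (here x≡v)
    ...   | no v∉U′ = Safe-remove safe λ p x∈U y∈U through →
                        contradiction (partner-unclaimed p x∈U y∈U (partner-through eq p through)) v∉U′
      where
      partner-unclaimed : ∀ {x y} → (x , y) ∈ P → x ∈ U → y ∈ U →
        (x ≡ u × y ≡ v) ⊎ (y ≡ u × x ≡ v) → v ∈ remove u U
      partner-unclaimed p _ y∈U (inj₁ (refl , refl)) = ∈-remove⁺ y∈U (λ y≡x → pair-≢ P! p (sym y≡x))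
      partner-unclaimed p x∈U _ (inj₂ (refl , refl)) = ∈-remove⁺ x∈U (pair-≢ P! p)

    module _ {V s t} (final : ∀ M → MeetsAll P M → t ≤ score s V M) where

      final-safe : Safe M [] → t ≤ score s V M
      final-safe {M} safe = final M λ p → met (safe p)
        where
        met : ∀ {x y} → x ∈ M ⊎ y ∈ M ⊎ (x ∈ [] × y ∈ []) → x ∈ M ⊎ y ∈ M
        met (inj₁ x∈M)        = inj₁ x∈M
        met (inj₂ (inj₁ y∈M)) = inj₂ y∈M
        met (inj₂ (inj₂ (() , _)))

      shrink : ∀ {n} → u ∈ U → length U ≤ suc n → length (remove u U) ≤ n
      shrink u∈U len = ≤-pred (≤-trans (length-remove u∈U) len)

      mutual
        makerTree : ∀ n {f M U} → length U ≤ n → Pending f M U → MakerTurn V s t P f M U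
        makerTree _ {nothing} {U = []} _ safe = mEnd (final-safe safe)
        makerTree _ {just _}  {U = []} _ (() , _)
        makerTree zero {U = _ ∷ _} ()
        makerTree (suc n) {nothing} {U = U@(_ ∷ _)} len safe =
          mFree (here refl) (breakerTree n (shrink {U = U} (here refl) len) (Safe-take safe))
        makerTree (suc n) {just _} {U = _ ∷ _} len (v∈U , safe) =
          mForced v∈U (breakerTree n (shrink v∈U len) safe)

        breakerTree : ∀ n {M U} → length U ≤ n → Safe M U → BreakerTurn V s t P M U
        breakerTree _ {U = []} _ safe = bEnd (final-safe safe)
        breakerTree zero {U = _ ∷ _} ()
        breakerTree (suc n) {U = _ ∷ _} len safe =
          bStep λ u u∈U → makerTree n (shrink u∈U len) (Safe-after-breaker safe)

  pairing-guarantees : ∀ {V s t P} → IsPairing V P → (∀ M → MeetsAll P M → t ≤ score s V M) →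
    PairingGuarantees V s t
  pairing-guarantees {V} {P = P} (P! , P⊆V) final =
    P , (P! , P⊆V) , makerTree P! final (length V) ≤-refl initial
    where
    initial : Safe P! [] V
    initial p = inj₂ (inj₂ (All.lookup P⊆V (fst∈pairElems p) , All.lookup P⊆V (snd∈pairElems p)))

open PairingStrategy using (MeetsAll; pairElems-concatMap; pairing-guarantees)

module Lattice where

  open import Data.Nat as ℕ using (ℕ; suc; s≤s)
  import Data.Nat.Properties as ℕ
  open import Data.Integer using (ℤ; +_; _+_; _-_; _*_; _<_; 1ℤ; +<+)
  open import Data.Integer.Properties
    using (+-0-abelianGroup; +-injective; <-cmp; <⇒≢; +-monoʳ-<; *-monoˡ-≤-nonNeg; i<j⇒suc[i]≤j;
           i≤i+j; pos-+; m-n≡m⊖n; ⊖-≥; module ≤-Reasoning)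
  open import Algebra.Properties.AbelianGroup +-0-abelianGroup using (∙-cancelˡ; ∙-cancelʳ)
  open import Data.Integer.DivMod using (_/ℕ_; _%ℕ_; n%ℕd<d; a≡a%ℕn+[a/ℕn]*n)
  open import Data.Integer.Tactic.RingSolver using (solve-∀)
  open import Relation.Binary.Definitions using (tri<; tri≈; tri>)

  Cell : Set
  Cell = ℤ × ℤ

  Loc : Set
  Loc = ℕ × ℕ

  shift : Cell → Pt → Pt
  shift (k , l) (x , y) = (+ 7 * k + + 3 * l + x , + 2 * l + y)

  embed : Loc → Pt
  embed (a , b) = (+ a , + b)

  at : Cell → Loc → Pt
  at q c = shift q (embed c)

  _⊕_ : Cell → Cell → Cell
  (k , l) ⊕ (k′ , l′) = (k + k′ , l + l′)

  shift-⊕ : ∀ q d p → shift q (shift d p) ≡ shift (q ⊕ d) p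
  shift-⊕ (k , l) (k′ , l′) (x , y) = cong₂ _,_ (fst k l k′ l′ x) (snd l l′ y)
    where
    fst : ∀ k l k′ l′ x → + 7 * k + + 3 * l + (+ 7 * k′ + + 3 * l′ + x) ≡ + 7 * (k + k′) + + 3 * (l + l′) + x
    fst = solve-∀
    snd : ∀ l l′ y → + 2 * l + (+ 2 * l′ + y) ≡ + 2 * (l + l′) + y
    snd = solve-∀

  ⊕-cancelʳ : ∀ {q q′} d → q ⊕ d ≡ q′ ⊕ d → q ≡ q′
  ⊕-cancelʳ {k , l} {k′ , l′} (dk , dl) eq =
    cong₂ _,_ (∙-cancelʳ dk k k′ (cong proj₁ eq)) (∙-cancelʳ dl l l′ (cong proj₂ eq))

  at-injectiveʳ : ∀ q {c c′} → at q c ≡ at q c′ → c ≡ c′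
  at-injectiveʳ (k , l) eq =
    cong₂ _,_ (+-injective (∙-cancelˡ (+ 7 * k + + 3 * l) _ _ (cong proj₁ eq)))
              (+-injective (∙-cancelˡ (+ 2 * l) _ _ (cong proj₂ eq)))

  euclid-< : ∀ c {l l′ j} j′ → j ℕ.< c → l < l′ → + c * l + + j < + c * l′ + + j′
  euclid-< c {l} {l′} {j} j′ j<c l<l′ = begin-strict
    + c * l + + j    <⟨ +-monoʳ-< (+ c * l) (+<+ j<c) ⟩
    + c * l + + c    ≡⟨ distrib (+ c) l ⟩
    + c * (1ℤ + l)   ≤⟨ *-monoˡ-≤-nonNeg (+ c) (i<j⇒suc[i]≤j l<l′) ⟩
    + c * l′         ≤⟨ i≤i+j (+ c * l′) (+ j′) ⟩
    + c * l′ + + j′  ∎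
    where
    open ≤-Reasoning
    distrib : ∀ c l → c * l + c ≡ c * (1ℤ + l)
    distrib = solve-∀

  euclid-unique : ∀ c {l l′ j j′} → j ℕ.< c → j′ ℕ.< c →
    + c * l + + j ≡ + c * l′ + + j′ → l ≡ l′ × j ≡ j′
  euclid-unique c {l} {l′} j<c j′<c eq with <-cmp l l′
  ... | tri< l<l′ _ _ = contradiction eq (<⇒≢ (euclid-< c _ j<c l<l′))
  ... | tri≈ _ refl _ = refl , +-injective (∙-cancelˡ (+ c * l) _ _ eq)
  ... | tri> _ _ l>l′ = contradiction (sym eq) (<⇒≢ (euclid-< c _ j′<c l>l′))

  InBlock : Loc → Set
  InBlock (i , j) = i ℕ.< 7 × j ℕ.< 2

  cellOf : Pt → Cell
  cellOf (x , y) = ((x - + 3 * (y /ℕ 2)) /ℕ 7 , y /ℕ 2)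

  offsetOf : Pt → Loc
  offsetOf (x , y) = ((x - + 3 * (y /ℕ 2)) %ℕ 7 , y %ℕ 2)

  offsetOf-inBlock : ∀ p → InBlock (offsetOf p)
  offsetOf-inBlock (x , y) = n%ℕd<d (x - + 3 * (y /ℕ 2)) 7 , n%ℕd<d y 2

  at-cellOf : ∀ p → at (cellOf p) (offsetOf p) ≡ p
  at-cellOf (x , y) = cong₂ _,_ fst snd
    where
    open ≡-Reasoning
    l : ℤ
    l = y /ℕ 2
    x′ : ℤ
    x′ = x - + 3 * l
    fst : + 7 * (x′ /ℕ 7) + + 3 * l + + (x′ %ℕ 7) ≡ x
    fst = begin
      + 7 * (x′ /ℕ 7) + + 3 * l + + (x′ %ℕ 7)  ≡⟨ regroup (x′ /ℕ 7) l (+ (x′ %ℕ 7)) ⟩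
      + (x′ %ℕ 7) + x′ /ℕ 7 * + 7 + + 3 * l    ≡⟨ cong (_+ + 3 * l) (a≡a%ℕn+[a/ℕn]*n x′ 7) ⟨
      x′ + + 3 * l                             ≡⟨ unshift x (+ 3 * l) ⟩
      x                                        ∎
      where
      regroup : ∀ k l i → + 7 * k + + 3 * l + i ≡ i + k * + 7 + + 3 * l
      regroup = solve-∀
      unshift : ∀ x z → x - z + z ≡ x
      unshift = solve-∀
    snd : + 2 * l + + (y %ℕ 2) ≡ y
    snd = trans (comm l (+ (y %ℕ 2))) (sym (a≡a%ℕn+[a/ℕn]*n y 2))
      where
      comm : ∀ l j → + 2 * l + j ≡ j + l * + 2
      comm = solve-∀

  at-injective : ∀ {q q′ c c′} → InBlock c → InBlock c′ → at q c ≡ at q′ c′ → q ≡ q′ × c ≡ c′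
  at-injective {k , l} {k′ , l′} {i , j} {i′ , j′} (i<7 , j<2) (i′<7 , j′<2) eq
    with euclid-unique 2 {l} {l′} j<2 j′<2 (cong proj₂ eq)
  ... | refl , refl
    with euclid-unique 7 {k} {k′} i<7 i′<7
           (∙-cancelˡ (+ 3 * l) _ _ (trans (sym (regroup k i)) (trans (cong proj₁ eq) (regroup k′ i′))))
    where
    regroup : ∀ k i → + 7 * k + + 3 * l + + i ≡ + 3 * l + (+ 7 * k + + i)
    regroup k i = comm (+ 7 * k) (+ 3 * l) (+ i)
      where
      comm : ∀ a b c → a + b + c ≡ b + (a + c)
      comm = solve-∀
  ...   | refl , refl = refl , refl

  at-normalise : ∀ q c → at q c ≡ at (q ⊕ cellOf (embed c)) (offsetOf (embed c))
  at-normalise q c = begin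
    shift q (embed c)                                               ≡⟨ cong (shift q) (at-cellOf (embed c)) ⟨
    shift q (shift (cellOf (embed c)) (embed (offsetOf (embed c)))) ≡⟨ shift-⊕ q _ _ ⟩
    at (q ⊕ cellOf (embed c)) (offsetOf (embed c))                  ∎
    where open ≡-Reasoning

  ∈-range : ∀ {d a i} → a ℕ.≤ d → i ℕ.≤ d → + a - + i ∈ range d
  ∈-range {d} {a} {i} a≤d i≤d = subst (_∈ range d) shifted (∈-map⁺ (λ n → + n - + d) (∈-upTo⁺ bound))
    where
    bound : a ℕ.+ (d ℕ.∸ i) ℕ.< suc (d ℕ.+ d)
    bound = s≤s (ℕ.+-mono-≤ a≤d (ℕ.m∸n≤m d i))
    shifted : + (a ℕ.+ (d ℕ.∸ i)) - + d ≡ + a - + i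
    shifted = begin
      + (a ℕ.+ (d ℕ.∸ i)) - + d  ≡⟨ cong (_- + d) (pos-+ a (d ℕ.∸ i)) ⟩
      + a + + (d ℕ.∸ i) - + d    ≡⟨ cong (λ z → + a + z - + d) (trans (sym (⊖-≥ i≤d)) (sym (m-n≡m⊖n d i))) ⟩
      + a + (+ d - + i) - + d    ≡⟨ cancel (+ a) (+ d) (+ i) ⟩
      + a - + i                  ∎
      where
      open ≡-Reasoning
      cancel : ∀ a d i → a + (d - i) - d ≡ a - i
      cancel = solve-∀

  at-∈-box : ∀ {d} q {a b i j} → a ℕ.≤ d → b ℕ.≤ d → i ℕ.≤ d → j ℕ.≤ d →
    at q (a , b) ∈ box d (at q (i , j))
  at-∈-box {d} (k , l) {a} {b} {i} {j} a≤d b≤d i≤d j≤d =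
    subst (_∈ box d (X + + i , Y + + j)) (cong₂ _,_ (regroup X (+ i) (+ a)) (regroup Y (+ j) (+ b)))
      (∈-concatMap⁺ (λ di → map (λ dj → (X + + i + di , Y + + j + dj)) (range d))
        (lose (∈-range a≤d i≤d) (∈-map⁺ (λ dj → (X + + i + (+ a - + i) , Y + + j + dj)) (∈-range b≤d j≤d))))
    where
    X Y : ℤ
    X = + 7 * k + + 3 * l
    Y = + 2 * l
    regroup : ∀ X i a → X + i + (a - i) ≡ X + a
    regroup = solve-∀

open Lattice

module Gadget where

  open import Data.Nat as ℕ using (ℕ; suc; _≤_)
  import Data.Nat.Properties as ℕ
  open import Data.Integer using (ℤ; +_; _+_; _-_; _*_; 1ℤ)
  open import Data.Integer.Tactic.RingSolver using (solve-∀)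

  _≟L_ : DecidableEquality Loc
  _≟L_ = ≡-dec ℕ._≟_ ℕ._≟_

  open import Data.List.Membership.DecPropositional _≟L_ using () renaming (_∈?_ to _∈L?_)
  open import Data.List.Relation.Unary.Unique.DecPropositional _≟L_ using (unique?)

  -- The rhombus {0,…,3}² without the corners (0 , 0) and (3 , 3): a second fundamental
  -- domain of the lattice of cells, split into the seven pairs of Maker's strategy.
  gadgetPairs : List (Loc × Loc)
  gadgetPairs =
    ((1 , 3) , (3 , 2)) ∷ ((2 , 2) , (1 , 1)) ∷ ((3 , 1) , (2 , 3)) ∷ ((1 , 2) , (2 , 1)) ∷
    ((1 , 0) , (0 , 2)) ∷ ((0 , 3) , (3 , 0)) ∷ ((0 , 1) , (2 , 0)) ∷ []

  gadgetCells : List Loc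
  gadgetCells = concatMap (λ (x , y) → x ∷ y ∷ []) gadgetPairs

  pairsAt : Cell → List (Pt × Pt)
  pairsAt q = map (λ (x , y) → (at q x , at q y)) gadgetPairs

  LocalTriangle : Set
  LocalTriangle = Orient × Loc

  localAnchor : LocalTriangle → Loc
  localAnchor (up   , c)       = c
  localAnchor (down , (u , v)) = (suc u , suc v)

  localCorners : LocalTriangle → List Loc
  localCorners (up   , (u , v)) = (u , v) ∷ (suc u , v) ∷ (u , suc v) ∷ []
  localCorners (down , (u , v)) = (suc u , suc v) ∷ (suc u , v) ∷ (u , suc v) ∷ []

  place : Cell → LocalTriangle → Tri
  place q T = (proj₁ T , at q (localAnchor T))

  corners-place : ∀ q T → corners (place q T) ≡ map (at q) (localCorners T)
  corners-place (k , l) (up , (u , v)) =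
    cong₂ (λ a b → (X + + u , Y + + v) ∷ (a , Y + + v) ∷ (X + + u , b) ∷ []) (step X (+ u)) (step Y (+ v))
    where
    X Y : ℤ
    X = + 7 * k + + 3 * l
    Y = + 2 * l
    step : ∀ X u → X + u + 1ℤ ≡ X + (1ℤ + u)
    step = solve-∀
  corners-place (k , l) (down , (u , v)) =
    cong₂ (λ a b → (X + + suc u , Y + + suc v) ∷ (X + + suc u , b) ∷ (a , Y + + suc v) ∷ [])
          (step X (+ u)) (step Y (+ v))
    where
    X Y : ℤ
    X = + 7 * k + + 3 * l
    Y = + 2 * l
    step : ∀ X u → X + (1ℤ + u) - 1ℤ ≡ X + u
    step = solve-∀

  anchor∈localCorners : ∀ {P : Loc → Set} T → All P (localCorners T) → P (localAnchor T)
  anchor∈localCorners (up   , _) (p ∷ _) = p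
  anchor∈localCorners (down , _) (p ∷ _) = p

  InGadget : LocalTriangle → Set
  InGadget T = All (_∈ gadgetCells) (localCorners T)

  inGadget? : Decidable InGadget
  inGadget? T = all? (_∈L? gadgetCells) (localCorners T)

  gadgetTriangles : List LocalTriangle
  gadgetTriangles = filter inGadget? (cartesianProduct (up ∷ down ∷ []) (cartesianProduct (upTo 3) (upTo 3)))

  gadgetTriangle-inGadget : ∀ {T} → T ∈ gadgetTriangles → InGadget T
  gadgetTriangle-inGadget =
    proj₂ ∘′ ∈-filter⁻ inGadget? {xs = cartesianProduct (up ∷ down ∷ []) (cartesianProduct (upTo 3) (upTo 3))}

  gadget-forces :
    All (λ sel → Any (λ T → All (_∈ sel) (localCorners T)) gadgetTriangles) (selections gadgetPairs)
  gadget-forces =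
    from-yes (all? (λ sel → any? (λ T → all? (_∈L? sel) (localCorners T)) gadgetTriangles) (selections gadgetPairs))

  gadgetCells-unique : Unique gadgetCells
  gadgetCells-unique = from-yes (unique? gadgetCells)

  gadgetCells-small : All (λ (a , b) → a ≤ 6 × b ≤ 6) gadgetCells
  gadgetCells-small = from-yes (all? (λ (a , b) → (a ℕ.≤? 6) ×-dec (b ℕ.≤? 6)) gadgetCells)

  offsetOf-injective-on-gadget :
    All (λ c → All (λ c′ → offsetOf (embed c) ≡ offsetOf (embed c′) → c ≡ c′) gadgetCells) gadgetCells
  offsetOf-injective-on-gadget = from-yes
    (all? (λ c → all? (λ c′ → (offsetOf (embed c) ≟L offsetOf (embed c′)) →-dec (c ≟L c′)) gadgetCells) gadgetCells)

  gadget-disjoint : ∀ {q q′ c c′} → c ∈ gadgetCells → c′ ∈ gadgetCells → at q c ≡ at q′ c′ → q ≡ q′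
  gadget-disjoint {q} {q′} {c} {c′} c∈ c′∈ eq =
    ⊕-cancelʳ (cellOf (embed c)) (trans cells≡ (cong (λ c → q′ ⊕ cellOf (embed c)) (sym c≡c′)))
    where
    normalised : q ⊕ cellOf (embed c) ≡ q′ ⊕ cellOf (embed c′) × offsetOf (embed c) ≡ offsetOf (embed c′)
    normalised = at-injective {q ⊕ cellOf (embed c)} {q′ ⊕ cellOf (embed c′)}
                   (offsetOf-inBlock (embed c)) (offsetOf-inBlock (embed c′))
                   (trans (sym (at-normalise q c)) (trans eq (at-normalise q′ c′)))
    cells≡ : q ⊕ cellOf (embed c) ≡ q′ ⊕ cellOf (embed c′)
    cells≡ = proj₁ normalised
    c≡c′ : c ≡ c′
    c≡c′ = All.lookup (All.lookup offsetOf-injective-on-gadget c∈) c′∈ (proj₂ normalised)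

  triangle-in-gadget : ∀ {q M} → MeetsAll (pairsAt q) M →
    Any (λ T → All (λ c → at q c ∈ M) (localCorners T)) gadgetTriangles
  triangle-in-gadget {q} meets =
    forced-by-pairing localCorners gadgetPairs gadget-forces
      (λ p → meets (∈-map⁺ (λ (x , y) → (at q x , at q y)) p))

open Gadget

module WinningSets where

  open import Data.Nat as ℕ using (_≤_; _*_; _+_)
  import Data.Nat.Properties as ℕ
  open import Data.List.Properties using (filter-all)
  import Data.Integer as ℤ

  private variable
    V M : List Pt
    v : Pt

  anchor∈corners : ∀ {P : Pt → Set} o → P v → Any P (corners (o , v))
  anchor∈corners up   Pv = here Pv
  anchor∈corners down Pv = here Pv

  corners-anchor : ∀ {P : Pt → Set} o → All P (corners (o , v)) → P v
  corners-anchor up   (Pv ∷ _) = Pv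
  corners-anchor down (Pv ∷ _) = Pv

  anchor∈orientations : ∀ o → (o , v) ∈ (up , v) ∷ (down , v) ∷ []
  anchor∈orientations up   = here refl
  anchor∈orientations down = there (here refl)

  ∈-winningSets : ∀ {T} → All (_∈ V) (corners T) → T ∈ winningSets V
  ∈-winningSets {V} {o , v} inV =
    ∈-filter⁺ (λ T → all? (_∈? V) (corners T))
      (∈-concatMap⁺ (λ v → (up , v) ∷ (down , v) ∷ []) (lose (corners-anchor o inV) (anchor∈orientations o)))
      inV

  winningSet-inside : ∀ {T} → T ∈ winningSets V → All (_∈ V) (corners T)
  winningSet-inside {V} =
    proj₂ ∘′ ∈-filter⁻ (λ T → all? (_∈? V) (corners T)) {xs = concatMap (λ v → (up , v) ∷ (down , v) ∷ []) V}

  winningSets-unique : Unique V → Unique (winningSets V)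
  winningSets-unique V! =
    Unique.filter⁺ _
      (concatMap-unique (λ v → (up , v) ∷ (down , v) ∷ []) V! (λ _ → ((λ ()) ∷ []) ∷ [] ∷ []) same-anchor)
    where
    anchored : ∀ {T v} → T ∈ (up , v) ∷ (down , v) ∷ [] → proj₂ T ≡ v
    anchored (here refl)         = refl
    anchored (there (here refl)) = refl
    same-anchor : ∀ {v v′ T} → T ∈ (up , v) ∷ (down , v) ∷ [] → T ∈ (up , v′) ∷ (down , v′) ∷ [] → v ≡ v′
    same-anchor T∈ T∈′ = trans (sym (anchored T∈)) (anchored T∈′)

  claimed-winning : ∀ {T} → All (_∈ M) (corners T) → 3 ≤ length (filter (_∈? M) (corners T))
  claimed-winning {M} {o , v} inM rewrite filter-all (_∈? M) inM with o
  ... | up   = ℕ.≤-refl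
  ... | down = ℕ.≤-refl

  _≟C_ : DecidableEquality Cell
  _≟C_ = ≡-dec ℤ._≟_ ℤ._≟_

  open import Data.List.Relation.Unary.Unique.DecPropositional.Properties _≟C_ using (deduplicate-!)

  module GadgetCount (V : List Pt) (V! : Unique V) where

    Full : Cell → Set
    Full q = All (λ c → at q c ∈ V) gadgetCells

    full? : Decidable Full
    full? q = all? (λ c → at q c ∈? V) gadgetCells

    fullCells : List Cell
    fullCells = filter full? (deduplicate _≟C_ (map cellOf V))

    fullCells-unique : Unique fullCells
    fullCells-unique = Unique.filter⁺ full? (deduplicate-! (map cellOf V))

    fullCell-full : ∀ {q} → q ∈ fullCells → Full q
    fullCell-full = proj₂ ∘′ ∈-filter⁻ full? {xs = deduplicate _≟C_ (map cellOf V)}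

    gadgetPairing : List (Pt × Pt)
    gadgetPairing = concatMap pairsAt fullCells

    gadgetPoints : Cell → List Pt
    gadgetPoints q = map (at q) gadgetCells

    gadgetPairing-isPairing : IsPairing V gadgetPairing
    gadgetPairing-isPairing rewrite pairElems-concatMap pairsAt fullCells = unique , inside
      where
      disjoint : ∀ {q q′ z} → z ∈ gadgetPoints q → z ∈ gadgetPoints q′ → q ≡ q′
      disjoint {q} {q′} z∈ z∈′ with ∈-map⁻ (at q) z∈ | ∈-map⁻ (at q′) z∈′
      ... | c , c∈ , refl | c′ , c′∈ , eq = gadget-disjoint {q} {q′} c∈ c′∈ eq
      unique : Unique (concatMap gadgetPoints fullCells)
      unique = concatMap-unique gadgetPoints fullCells-unique
                 (λ q → Unique.map⁺ (at-injectiveʳ q) gadgetCells-unique) disjoint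
      inside : All (_∈ V) (concatMap gadgetPoints fullCells)
      inside = All.concat⁺ (All.map⁺ {f = gadgetPoints}
                 (All.map (λ {q} → All.map⁺ {f = at q}) (All.all-filter full? (deduplicate _≟C_ (map cellOf V)))))

    data AnchoredIn (q : Cell) (T : Tri) : Set where
      anchored : ∀ {c} → c ∈ gadgetCells → proj₂ T ≡ at q c → AnchoredIn q T

    makerWins : List Pt → List Tri
    makerWins M = filter (λ T → 3 ℕ.≤? length (filter (_∈? M) (corners T))) (winningSets V)

    placed-wins : ∀ {q M T} → q ∈ fullCells → T ∈ gadgetTriangles →
      All (λ c → at q c ∈ M) (localCorners T) → place q T ∈ makerWins M
    placed-wins {q} {M} {T} q∈ T∈ inM =
      ∈-filter⁺ (λ T → 3 ℕ.≤? length (filter (_∈? M) (corners T)))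
        (∈-winningSets {V} {place q T} inV) (claimed-winning {M} {place q T} inM′)
      where
      inV : All (_∈ V) (corners (place q T))
      inV = subst (All (_∈ V)) (sym (corners-place q T))
              (All.map⁺ (All.map (All.lookup (fullCell-full q∈)) (gadgetTriangle-inGadget T∈)))
      inM′ : All (_∈ M) (corners (place q T))
      inM′ = subst (All (_∈ M)) (sym (corners-place q T)) (All.map⁺ inM)

    won-in-gadget : ∀ {q M} → q ∈ fullCells → MeetsAll gadgetPairing M →
      ∃ λ T → T ∈ makerWins M × AnchoredIn q T
    won-in-gadget {q} {M} q∈ meets =
      let T , T∈ , inM = find (triangle-in-gadget {q} {M} λ p → meets (∈-concatMap⁺ pairsAt (lose q∈ p)))
      in place q T , placed-wins q∈ T∈ inM , anchored (anchor∈localCorners T (gadgetTriangle-inGadget T∈)) refl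

    score-≥-fullCells : ∀ M → MeetsAll gadgetPairing M → length fullCells ≤ score 3 V M
    score-≥-fullCells M meets =
      length-≤-injection AnchoredIn {ys = makerWins M} fullCells-unique (λ q∈ → won-in-gadget q∈ meets) same-gadget
      where
      same-gadget : ∀ {q q′ T} → AnchoredIn q T → AnchoredIn q′ T → q ≡ q′
      same-gadget {q} {q′} (anchored c∈ eq) (anchored c′∈ eq′) = gadget-disjoint {q} {q′} c∈ c′∈ (trans (sym eq) eq′)

    NearBoundary : Tri → Set
    NearBoundary T = Any (λ w → Any (λ p → ¬ p ∈ V) (box 6 w)) (corners T)

    nearBoundary? : Decidable NearBoundary
    nearBoundary? T = any? (λ w → any? (λ p → ¬? (p ∈? V)) (box 6 w)) (corners T)

    interior-box : ∀ o {v p} → ¬ NearBoundary (o , v) → p ∈ box 6 v → p ∈ V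
    interior-box o {p = p} interior p∈box =
      decidable-stable (p ∈? V) λ p∉V → interior (anchor∈corners o (lose p∈box p∉V))

    interior-full : ∀ o {v} → ¬ NearBoundary (o , v) → Full (cellOf v)
    interior-full o {v} interior = All.tabulate λ {c} c∈ →
      interior-box o interior (subst (λ w → at (cellOf v) c ∈ box 6 w) (at-cellOf v) (near c∈))
      where
      near : ∀ {c} → c ∈ gadgetCells → at (cellOf v) c ∈ box 6 (at (cellOf v) (offsetOf v))
      near c∈ with All.lookup gadgetCells-small c∈ | offsetOf-inBlock v
      ... | a≤6 , b≤6 | i<7 , j<2 =
        at-∈-box (cellOf v) a≤6 b≤6 (ℕ.≤-pred i<7) (ℕ.≤-trans (ℕ.≤-pred j<2) (ℕ.m≤m+n 1 5))

    blockTriangles : List (Orient × Loc)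
    blockTriangles = cartesianProduct (up ∷ down ∷ []) (cartesianProduct (upTo 7) (upTo 2))

    blockTriangle : Cell × (Orient × Loc) → Tri
    blockTriangle (q , o , c) = (o , at q c)

    interior-located : ∀ {T} → T ∈ filter (∁? nearBoundary?) (winningSets V) →
      ∃ λ y → y ∈ cartesianProduct fullCells blockTriangles × T ≡ blockTriangle y
    interior-located {o , v} T∈ =
      (cellOf v , o , offsetOf v) ,
      ∈-cartesianProduct⁺ cell∈ (∈-cartesianProduct⁺ (orientation∈ o)
        (∈-cartesianProduct⁺ (∈-upTo⁺ (proj₁ (offsetOf-inBlock v))) (∈-upTo⁺ (proj₂ (offsetOf-inBlock v))))) ,
      cong (o ,_) (sym (at-cellOf v))
      where
      T∈W : (o , v) ∈ winningSets V
      T∈W = proj₁ (∈-filter⁻ (∁? nearBoundary?) {xs = winningSets V} T∈)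
      interior : ¬ NearBoundary (o , v)
      interior = proj₂ (∈-filter⁻ (∁? nearBoundary?) {xs = winningSets V} T∈)
      cell∈ : cellOf v ∈ fullCells
      cell∈ = ∈-filter⁺ full? (∈-deduplicate⁺ _≟C_ (∈-map⁺ cellOf (corners-anchor o (winningSet-inside {V} T∈W))))
                (interior-full o interior)
      orientation∈ : ∀ o → o ∈ up ∷ down ∷ []
      orientation∈ up   = here refl
      orientation∈ down = there (here refl)

    interior-≤ : length (filter (∁? nearBoundary?) (winningSets V)) ≤ length fullCells * 28
    interior-≤ = ℕ.≤-trans
      (length-≤-injection (λ T y → T ≡ blockTriangle y)
         (Unique.filter⁺ (∁? nearBoundary?) (winningSets-unique V!)) interior-located (λ e e′ → trans e (sym e′)))
      (ℕ.≤-reflexive (length-cartesianProduct fullCells blockTriangles))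

    numWin-≤ : numWin V ≤ boundaryCount V 6 + 28 * length fullCells
    numWin-≤ = begin
      numWin V
        ≡⟨ length-filter-∁ nearBoundary? (winningSets V) ⟨
      boundaryCount V 6 + length (filter (∁? nearBoundary?) (winningSets V))
        ≤⟨ ℕ.+-monoʳ-≤ (boundaryCount V 6) interior-≤ ⟩
      boundaryCount V 6 + length fullCells * 28
        ≡⟨ cong (boundaryCount V 6 +_) (ℕ.*-comm (length fullCells) 28) ⟩
      boundaryCount V 6 + 28 * length fullCells
        ∎
      where open ℕ.≤-Reasoning

open WinningSets

open import Data.Nat using (ℕ; _≤_; _*_; _+_)
open import Data.Nat.Properties using (*-monoʳ-≤; *-distribˡ-+; +-monoˡ-≤; m≤n*m; +-comm; *-assoc; *-comm; module ≤-Reasoning)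

gadget-pairing-score : ∀ V → Unique V →
  Σ ℕ λ t → PairingGuarantees V 3 t × numWin V ≤ boundaryCount V 6 + 28 * t
gadget-pairing-score V V! =
  length fullCells , pairing-guarantees gadgetPairing-isPairing score-≥-fullCells , numWin-≤
  where open GadgetCount V V!

scale-bound : ∀ k t {n b} → k * b ≤ n → n ≤ b + 28 * t → k * n ≤ 28 * k * t + 28 * n
scale-bound k t {n} {b} kb≤n n≤b+28t = begin
  k * n                 ≤⟨ *-monoʳ-≤ k n≤b+28t ⟩
  k * (b + 28 * t)      ≡⟨ *-distribˡ-+ k b (28 * t) ⟩
  k * b + k * (28 * t)  ≤⟨ +-monoˡ-≤ (k * (28 * t)) kb≤n ⟩
  n + k * (28 * t)      ≡⟨ cong (n +_) (trans (sym (*-assoc k 28 t)) (cong (_* t) (*-comm k 28))) ⟩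
  n + 28 * k * t        ≤⟨ +-monoˡ-≤ (28 * k * t) (m≤n*m n 28) ⟩
  28 * n + 28 * k * t   ≡⟨ +-comm (28 * n) (28 * k * t) ⟩
  28 * k * t + 28 * n   ∎
  where open ≤-Reasoning

theorem8 : (G : ℕ → List Pt) → (∀ m → Unique (G m)) →
    (∀ d k → 1 ≤ k → Σ ℕ λ M → ∀ m → M ≤ m → k * boundaryCount (G m) d ≤ numWin (G m)) →
    ∀ k → 1 ≤ k → Σ ℕ λ M → ∀ m → M ≤ m →
      Σ ℕ λ t → PairingGuarantees (G m) 3 t × (k * numWin (G m) ≤ 28 * k * t + 28 * numWin (G m))
theorem8 G G! boundary-small k k≥1 =
  let m₀ , small = boundary-small 6 k k≥1
  in m₀ , λ m m₀≤m →
    let t , guaranteed , bound = gadget-pairing-score (G m) (G! m)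
    in t , guaranteed , scale-bound k t (small m m₀≤m) bound
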